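{- Let $(G,\omega)$, $G=(V,E)$, be a finite, connected, loop-free directed multigraph with positive integer arc weight $\omega:E\to\mathbb{N}^+$ such that every arc lies on a directed cycle. Then $$\Omega(G,\omega)\ \ge\ \max\{\mu(G,\omega),\upsilon(G,\omega)\}.$$ Moreover, there are infinitely many such weighted graphs $(G,\omega)$ with $\mu(G,\omega)=\Omega(G,\omega)$ or $\upsilon(G,\omega)=\Omega(G,\omega)$.
   Context: $\Omega(G,\omega)$ is the minimum of $\sum_{e\in\epsilon}\omega(e)$ over all $\epsilon\subseteq E$ with $G\setminus\epsilon$ acyclic (no directed cycle). $O_{el}(G)$ is the set of elementary cycles (directed cycles visiting no vertex twice). For $e\in E$: $\theta_G(e)$ is the number of elementary cycles containing $e$; $\varphi_G(e)$ is the number of arcs of the subgraph $G_{el}(e)$ induced by all elementary cycles containing $e$; $\xi_{G,\omega}(e)=\theta_G(e)/\omega(e)$ and $\eta_{G,\omega}(e)=\varphi_G(e)/\omega(e)$. Let $\xi_{\max}=\max_{e\in E}\xi_{G,\omega}(e)$, $\eta_{\max}=\max_{e\in E}\eta_{G,\omega}(e)$, $\mu(G,\omega)=\lceil |O_{el}(G)|/\xi_{\max}\rceil$ and $\upsilon(G,\omega)=\lceil |E|/\eta_{\max}\rceil$. -}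

module Defs where

open import Data.Nat as ℕ using (ℕ; zero; suc; _≤_; _<_)
open import Data.Fin using (Fin)
open import Data.Fin.Subset as Sub using (Subset; ⋃; ∣_∣)
open import Data.Fin.Subset.Properties using (_∈?_)
open import Data.List using (List; []; _∷_; map; filter; length; allFin; foldr)
open import Data.Nat.ListAction using (sum)
open import Data.List.Membership.Propositional as LM using ()
open import Data.List.Relation.Unary.All using (All)
open import Data.List.Relation.Unary.Unique.Propositional using (Unique)
open import Data.Integer as ℤ using (ℤ; +_)
open import Data.Rational as ℚ using (ℚ; 0ℚ; _÷_; ceiling; ≢-nonZero)
open import Data.Rational.Properties using (_≟_)
open import Data.Product using (Σ; ∃; ∃-syntax; _×_; _,_)
open import Data.Sum using (_⊎_)
open import Relation.Nullary using (¬_; yes; no)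
open import Relation.Binary.PropositionalEquality using (_≡_; _≢_)
open import Relation.Binary.Construct.Closure.ReflexiveTransitive using (Star)
open import Function.Bundles using (_⇔_)

record Digraph : Set where
  field
    n   : ℕ
    m   : ℕ
    src : Fin m → Fin n
    tgt : Fin m → Fin n

module _ (G : Digraph) where
  open Digraph G

  Vertex = Fin n
  Arc    = Fin m

  LoopFree : Set
  LoopFree = ∀ e → src e ≢ tgt e

  Adjacent : Vertex → Vertex → Set
  Adjacent u v = ∃[ e ] ((src e ≡ u × tgt e ≡ v) ⊎ (src e ≡ v × tgt e ≡ u))

  Connected : Set
  Connected = ∀ u v → Star Adjacent u v

  data Walk : Vertex → List Arc → Vertex → Set where
    []  : ∀ {u} → Walk u [] u
    _∷_ : ∀ {u e l v} → src e ≡ u → Walk (tgt e) l v → Walk u (e ∷ l) v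

  DirectedCycle : List Arc → Set
  DirectedCycle l = (l ≢ []) × ∃[ u ] Walk u l u

  -- elementary cycle: directed cycle visiting no vertex twice
  -- (the visited vertices are the sources of its arcs)
  ElementaryCycle : List Arc → Set
  ElementaryCycle l = DirectedCycle l × Unique (map src l)

  -- An elementary cycle (up to rotation) is identified with its arc set.
  IsElemCycle : Subset m → Set
  IsElemCycle C = ∃[ l ] (ElementaryCycle l × (∀ e → (e Sub.∈ C) ⇔ (e LM.∈ l)))

  EveryArcOnCycle : Set
  EveryArcOnCycle = ∀ e → ∃[ l ] (ElementaryCycle l × e LM.∈ l)

  AcyclicWithout : Subset m → Set
  AcyclicWithout ε = ¬ (∃[ l ] (DirectedCycle l × All (λ e → ¬ (e Sub.∈ ε)) l))

  -- O_el(G) given as a duplicate-free list of all elementary cycles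
  EnumeratesCycles : List (Subset m) → Set
  EnumeratesCycles L = Unique L × (∀ C → (C LM.∈ L) ⇔ IsElemCycle C)

  module _ (ω : Arc → ℕ) where

    PositiveWeight : Set
    PositiveWeight = ∀ e → 0 < ω e

    Admissible : Set
    Admissible = LoopFree × Connected × PositiveWeight × EveryArcOnCycle

    weight : Subset m → ℕ
    weight ε = sum (map ω (filter (_∈? ε) (allFin m)))

    IsΩ : ℕ → Set
    IsΩ w = (∃[ ε ] (AcyclicWithout ε × weight ε ≡ w))
          × (∀ ε → AcyclicWithout ε → w ≤ weight ε)

-- rational division; the (never used) division by zero is set to 0
divℕ : ℕ → ℕ → ℚ
divℕ a zero    = 0ℚ
divℕ a (suc b) = (+ a) ℚ./ suc b

divℚ : ℚ → ℚ → ℚ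
divℚ p q with q ≟ 0ℚ
... | yes _  = 0ℚ
... | no q≢0 = _÷_ p q {{≢-nonZero q≢0}}

maxℚ : List ℚ → ℚ
maxℚ = foldr ℚ._⊔_ 0ℚ

module _ (G : Digraph) (ω : Arc G → ℕ) (L : List (Subset (Digraph.m G))) where
  open Digraph G

  cyclesThrough : Arc G → List (Subset m)
  cyclesThrough e = filter (e ∈?_) L

  θ : Arc G → ℕ
  θ e = length (cyclesThrough e)

  φ : Arc G → ℕ
  φ e = ∣ ⋃ (cyclesThrough e) ∣

  ξ : Arc G → ℚ
  ξ e = divℕ (θ e) (ω e)

  η : Arc G → ℚ
  η e = divℕ (φ e) (ω e)

  ξmax : ℚ
  ξmax = maxℚ (map ξ (allFin m))

  ηmax : ℚ
  ηmax = maxℚ (map η (allFin m))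

  μ : ℤ
  μ = ceiling (divℚ ((+ length L) ℚ./ 1) ξmax)

  υ : ℤ
  υ = ceiling (divℚ ((+ m) ℚ./ 1) ηmax)

module Submission where

-- Let ε be a minimum-weight feedback arc set, so weight ε = Ω. Every elementary cycle meets ε,
-- hence |O_el| ≤ Σ_{e ∈ ε} θ(e) ≤ ξmax · Σ_{e ∈ ε} ω(e) = ξmax · Ω. Every arc lies on an elementary
-- cycle, which passes through some e ∈ ε, so the arcs of the subgraphs G_el(e), e ∈ ε, cover E and
-- |E| ≤ Σ_{e ∈ ε} φ(e) ≤ ηmax · Ω. Dividing and taking ceilings gives μ ≤ Ω and υ ≤ Ω.
-- Equality μ = Ω = 1 holds for two vertices joined by one arc and any number of parallel return arcs.

open import Defs
open import Data.Nat as ℕ using (ℕ; zero; suc; _≤_; _<_; z≤n; s≤s)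
import Data.Nat.Properties as ℕP
open import Data.Integer as ℤ using (+_; _⊔_; _≥_)
import Data.Integer.Properties as ℤP
import Data.Integer.DivMod as ℤD
open import Data.Rational as ℚ using (ℚ; mkℚ; 0ℚ; 1ℚ; _/_; _÷_; 1/_; ceiling; toℚᵘ; Positive)
import Data.Rational.Properties as ℚP
open import Data.Rational.Unnormalised as ℚᵘ using (mkℚᵘ; *≤*)
import Data.Rational.Unnormalised.Properties as ℚᵘP
open import Data.List using (List; []; _∷_; map; filter; length; allFin; foldr; tabulate)
import Data.List.Properties as LP
open import Data.Nat.ListAction using (sum)
open import Data.List.Membership.Propositional using (_∈_; find)
open import Data.List.Membership.Propositional.Properties
  using (∈-map⁺; ∈-map⁻; ∈-filter⁺; ∈-allFin; ∈-tabulate⁺; ∈-tabulate⁻)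
open import Data.List.Relation.Unary.Any using (here; there; any?)
open import Data.List.Relation.Unary.All using (All; []; _∷_)
import Data.List.Relation.Unary.All.Properties as AllP
open import Data.List.Relation.Unary.All.Properties.Core using (¬Any⇒All¬)
open import Data.List.Relation.Unary.AllPairs using ([]; _∷_)
open import Data.List.Relation.Unary.Unique.Propositional using (Unique)
import Data.List.Relation.Unary.Unique.Propositional.Properties as UniqueP
open import Data.Fin using (Fin; zero; suc)
import Data.Fin.Properties as FinP
open import Data.Fin.Subset as Sub using (Subset; ⋃; ∣_∣; ⊥; ⊤; ⁅_⁆; _∪_; inside; outside)
open import Data.Fin.Subset.Properties
  using (_∈?_; x∈p∪q⁻; x∈p∪q⁺; x∈⁅x⁆; x∈⁅y⁆⇒x≡y; ∉⊥; ∣⊥∣≡0; ∣⊤∣≡n; p⊆q⇒∣p∣≤∣q∣; ⊆-antisym)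
open import Data.Vec using (_∷_; [])
open import Data.Product using (_×_; _,_; ∃-syntax; Σ-syntax; proj₁)
open import Data.Sum using (_⊎_; inj₁; inj₂)
open import Data.Empty using (⊥-elim)
open import Relation.Nullary using (¬_; Dec; yes; no)
open import Relation.Binary.PropositionalEquality
open import Relation.Binary.Construct.Closure.ReflexiveTransitive as Star using (_◅_)
open import Function using (_∘_; id)
open import Function.Bundles using (_⇔_; mk⇔; Equivalence)
open import Function.Properties.Equivalence using () renaming (trans to ⇔-trans; sym to ⇔-sym)

≤-/ℕ : ∀ i j D .{{_ : ℕ.NonZero D}} → i ℤ.* + D ℤ.≤ j → i ℤ.≤ j ℤ./ℕ D
≤-/ℕ i j D iD≤j = subst (i ℤ.≤_) (ℤP.pred-suc (j ℤ./ℕ D)) (ℤP.i<j⇒i≤pred[j] i<1+j/D)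
  where
  i<1+j/D : i ℤ.< ℤ.suc (j ℤ./ℕ D)
  i<1+j/D = ℤP.*-cancelʳ-<-nonNeg (+ D) (ℤP.≤-<-trans iD≤j (ℤD.n<s[n/ℕd]*d j D))

neg-floor-neg-≤ : ∀ n D i .{{_ : ℕ.NonZero D}} → n ℤ.* + 1 ℤ.≤ i ℤ.* + D →
                  ℤ.- ((ℤ.- n) ℤ./ + D) ℤ.≤ i
neg-floor-neg-≤ n D i n≤iD = begin
  ℤ.- ((ℤ.- n) ℤ./ + D)  ≡⟨ cong ℤ.-_ (ℤD.div-pos-is-/ℕ (ℤ.- n) D) ⟩
  ℤ.- ((ℤ.- n) ℤ./ℕ D)   ≤⟨ ℤP.neg-mono-≤ (≤-/ℕ (ℤ.- i) (ℤ.- n) D -iD≤-n) ⟩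
  ℤ.- (ℤ.- i)            ≡⟨ ℤP.neg-involutive i ⟩
  i                      ∎
  where
  open ℤP.≤-Reasoning
  -iD≤-n : ℤ.- i ℤ.* + D ℤ.≤ ℤ.- n
  -iD≤-n = subst₂ ℤ._≤_ (ℤP.neg-distribˡ-* i (+ D)) (cong ℤ.-_ (ℤP.*-identityʳ n)) (ℤP.neg-mono-≤ n≤iD)

-- ceiling p = - floor (- p) = - ((- n) / D) for p = n / D in lowest terms.
ceiling-≤ : ∀ p i → p ℚ.≤ i / 1 → ceiling p ℤ.≤ i
ceiling-≤ p i p≤i with ℚᵘP.≤-respʳ-≃ (ℚP.toℚᵘ-fromℚᵘ (mkℚᵘ i 0)) (ℚP.toℚᵘ-mono-≤ p≤i)
ceiling-≤ (mkℚ (+ zero)  d _) i _ | *≤* n≤iD = neg-floor-neg-≤ (+ zero) (suc d) i n≤iD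
ceiling-≤ (mkℚ ℤ.+[1+ n ] d _) i _ | *≤* n≤iD = neg-floor-neg-≤ ℤ.+[1+ n ] (suc d) i n≤iD
ceiling-≤ (mkℚ ℤ.-[1+ n ] d _) i _ | *≤* n≤iD = neg-floor-neg-≤ ℤ.-[1+ n ] (suc d) i n≤iD

/-≤-/⇔ : ∀ a b c d → ((+ a) / suc b ℚ.≤ (+ c) / suc d) ⇔ (a ℕ.* suc d ℕ.≤ c ℕ.* suc b)
/-≤-/⇔ a b c d = mk⇔ to from
  where
  a/b≃ : toℚᵘ ((+ a) / suc b) ℚᵘ.≃ mkℚᵘ (+ a) b
  a/b≃ = ℚP.toℚᵘ-fromℚᵘ (mkℚᵘ (+ a) b)
  c/d≃ : toℚᵘ ((+ c) / suc d) ℚᵘ.≃ mkℚᵘ (+ c) d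
  c/d≃ = ℚP.toℚᵘ-fromℚᵘ (mkℚᵘ (+ c) d)
  to : (+ a) / suc b ℚ.≤ (+ c) / suc d → a ℕ.* suc d ℕ.≤ c ℕ.* suc b
  to le with ℚᵘP.≤-respˡ-≃ a/b≃ (ℚᵘP.≤-respʳ-≃ c/d≃ (ℚP.toℚᵘ-mono-≤ le))
  ... | *≤* h = ℤP.drop‿+≤+ (subst₂ ℤ._≤_ (sym (ℤP.pos-* a (suc d))) (sym (ℤP.pos-* c (suc b))) h)
  from : a ℕ.* suc d ℕ.≤ c ℕ.* suc b → (+ a) / suc b ℚ.≤ (+ c) / suc d
  from le = ℚP.toℚᵘ-cancel-≤ (ℚᵘP.≤-respˡ-≃ (ℚᵘP.≃-sym a/b≃) (ℚᵘP.≤-respʳ-≃ (ℚᵘP.≃-sym c/d≃)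
    (*≤* (subst₂ ℤ._≤_ (ℤP.pos-* a (suc d)) (ℤP.pos-* c (suc b)) (ℤ.+≤+ le)))))

+/1-mono-≤ : ∀ a b → a ℕ.≤ b → (+ a) / 1 ℚ.≤ (+ b) / 1
+/1-mono-≤ a b a≤b = Equivalence.from (/-≤-/⇔ a 0 b 0) (ℕP.*-monoˡ-≤ 1 a≤b)

0/suc≡0ℚ : ∀ d → (+ 0) / suc d ≡ 0ℚ
0/suc≡0ℚ d = ℚP.toℚᵘ-injective (ℚᵘP.≃-trans (ℚP.toℚᵘ-fromℚᵘ (mkℚᵘ (+ 0) d)) (ℚᵘ.*≡* refl))

/1-*-/ : ∀ a c d → ((+ a) / 1) ℚ.* ((+ c) / suc d) ≡ (+ (a ℕ.* c)) / suc d
/1-*-/ a c d = ℚP.toℚᵘ-injective (begin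
  toℚᵘ (((+ a) / 1) ℚ.* ((+ c) / suc d))
    ≈⟨ ℚP.toℚᵘ-homo-* ((+ a) / 1) ((+ c) / suc d) ⟩
  toℚᵘ ((+ a) / 1) ℚᵘ.* toℚᵘ ((+ c) / suc d)
    ≈⟨ ℚᵘP.*-cong (ℚP.toℚᵘ-fromℚᵘ (mkℚᵘ (+ a) 0)) (ℚP.toℚᵘ-fromℚᵘ (mkℚᵘ (+ c) d)) ⟩
  mkℚᵘ (+ a) 0 ℚᵘ.* mkℚᵘ (+ c) d
    ≡⟨ cong₂ mkℚᵘ (sym (ℤP.pos-* a c)) (ℕP.+-identityʳ d) ⟩
  mkℚᵘ (+ (a ℕ.* c)) d
    ≈⟨ ℚᵘP.≃-sym (ℚP.toℚᵘ-fromℚᵘ (mkℚᵘ (+ (a ℕ.* c)) d)) ⟩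
  toℚᵘ ((+ (a ℕ.* c)) / suc d) ∎)
  where open ℚᵘP.≃-Reasoning

÷-≤ : ∀ p q r .{{_ : Positive q}} → p ℚ.≤ r ℚ.* q → (p ÷ q) {{ℚP.pos⇒nonZero q}} ℚ.≤ r
÷-≤ p q r p≤rq = begin
  p ℚ.* 1/ q           ≤⟨ ℚP.*-monoʳ-≤-nonNeg (1/ q) {{1/q≥0}} p≤rq ⟩
  r ℚ.* q ℚ.* 1/ q     ≡⟨ ℚP.*-assoc r q (1/ q) ⟩
  r ℚ.* (q ℚ.* 1/ q)   ≡⟨ cong (r ℚ.*_) (ℚP.*-inverseʳ q) ⟩
  r ℚ.* 1ℚ             ≡⟨ ℚP.*-identityʳ r ⟩
  r                    ∎
  where
  open ℚP.≤-Reasoning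
  instance
    q≢0 : ℚ.NonZero q
    q≢0 = ℚP.pos⇒nonZero q
  1/q≥0 : ℚ.NonNegative (1/ q)
  1/q≥0 = ℚP.pos⇒nonNeg (1/ q) {{ℚP.1/pos⇒pos q}}

divℚ-pos : ∀ p q .{{_ : Positive q}} → divℚ p q ≡ (p ÷ q) {{ℚP.pos⇒nonZero q}}
divℚ-pos p q with q ℚP.≟ 0ℚ
... | yes q≡0 = ⊥-elim (ℚP.<-irrefl (sym q≡0) (ℚP.positive⁻¹ q))
... | no _    = refl

ceiling-/-≤ : ∀ T w c d → T ℕ.* suc d ℕ.≤ suc c ℕ.* w →
              ceiling (divℚ ((+ T) / 1) ((+ suc c) / suc d)) ℤ.≤ + w
ceiling-/-≤ T w c d Td≤cw = begin
  ceiling (divℚ ((+ T) / 1) q)                    ≡⟨ cong ceiling (divℚ-pos ((+ T) / 1) q) ⟩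
  ceiling (((+ T) / 1 ÷ q) {{ℚP.pos⇒nonZero q}})  ≤⟨ ceiling-≤ _ (+ w) (÷-≤ ((+ T) / 1) q ((+ w) / 1) T≤wq) ⟩
  + w                                             ∎
  where
  open ℤP.≤-Reasoning
  q : ℚ
  q = (+ suc c) / suc d
  instance
    q>0 : Positive q
    q>0 = ℚP.normalize-pos (suc c) (suc d)
  cw≡wc*1 : suc c ℕ.* w ≡ w ℕ.* suc c ℕ.* 1
  cw≡wc*1 = trans (ℕP.*-comm (suc c) w) (sym (ℕP.*-identityʳ _))
  T≤wq : (+ T) / 1 ℚ.≤ ((+ w) / 1) ℚ.* q
  T≤wq = subst ((+ T) / 1 ℚ.≤_) (sym (/1-*-/ w (suc c) d))
    (Equivalence.from (/-≤-/⇔ T 0 (w ℕ.* suc c) d) (subst (T ℕ.* suc d ℕ.≤_) cw≡wc*1 Td≤cw))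

maxℚ-upper : ∀ ys {q} → q ∈ ys → q ℚ.≤ maxℚ ys
maxℚ-upper (y ∷ ys) (here refl) = ℚP.p≤p⊔q y (maxℚ ys)
maxℚ-upper (y ∷ ys) (there q∈ys) = ℚP.≤-trans (maxℚ-upper ys q∈ys) (ℚP.p≤q⊔p y (maxℚ ys))

maxℚ-lub : ∀ ys {r} → 0ℚ ℚ.≤ r → (∀ {y} → y ∈ ys → y ℚ.≤ r) → maxℚ ys ℚ.≤ r
maxℚ-lub []       0≤r ys≤r = 0≤r
maxℚ-lub (y ∷ ys) 0≤r ys≤r = ℚP.⊔-lub (ys≤r (here refl)) (maxℚ-lub ys 0≤r (ys≤r ∘ there))

maxℚ-∷ : ∀ y ys → 0ℚ ℚ.≤ y → (∀ {z} → z ∈ ys → z ℚ.≤ y) → maxℚ (y ∷ ys) ≡ y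
maxℚ-∷ y ys 0≤y ys≤y = ℚP.p≥q⇒p⊔q≡p (maxℚ-lub ys 0≤y ys≤y)

maxℚ≡0⊎∈ : ∀ ys → maxℚ ys ≡ 0ℚ ⊎ maxℚ ys ∈ ys
maxℚ≡0⊎∈ []       = inj₁ refl
maxℚ≡0⊎∈ (y ∷ ys) with ℚP.⊔-sel y (maxℚ ys) | maxℚ≡0⊎∈ ys
... | inj₁ ⊔≡y | _          = inj₂ (here ⊔≡y)
... | inj₂ ⊔≡m | inj₁ m≡0   = inj₁ (trans ⊔≡m m≡0)
... | inj₂ ⊔≡m | inj₂ m∈ys  = inj₂ (there (subst (_∈ ys) (sym ⊔≡m) m∈ys))

sum-≤-scaled : ∀ {A : Set} (g ω : A → ℕ) D C (xs : List A) →
               (∀ {x} → x ∈ xs → g x ℕ.* D ℕ.≤ C ℕ.* ω x) →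
               sum (map g xs) ℕ.* D ℕ.≤ C ℕ.* sum (map ω xs)
sum-≤-scaled g ω D C []       _  = ℕ.z≤n
sum-≤-scaled g ω D C (x ∷ xs) gD≤Cω = begin
  (g x ℕ.+ sum (map g xs)) ℕ.* D        ≡⟨ ℕP.*-distribʳ-+ D (g x) _ ⟩
  g x ℕ.* D ℕ.+ sum (map g xs) ℕ.* D    ≤⟨ ℕP.+-mono-≤ (gD≤Cω (here refl))
                                                        (sum-≤-scaled g ω D C xs (gD≤Cω ∘ there)) ⟩
  C ℕ.* ω x ℕ.+ C ℕ.* sum (map ω xs)    ≡⟨ ℕP.*-distribˡ-+ C (ω x) _ ⟨
  C ℕ.* (ω x ℕ.+ sum (map ω xs))        ∎
  where open ℕP.≤-Reasoning

maxRatio : ∀ {A : Set} → (A → ℕ) → (A → ℕ) → List A → ℚ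
maxRatio g ω ys = maxℚ (map (λ a → divℕ (g a) (ω a)) ys)

divℕ-≤-/ : ∀ a o c d → 0 ℕ.< o → divℕ a o ℚ.≤ (+ c) / suc d → a ℕ.* suc d ℕ.≤ c ℕ.* o
divℕ-≤-/ a (suc o) c d _ = Equivalence.to (/-≤-/⇔ a o c d)

⌈/maxRatio⌉≤sum : ∀ {A : Set} (g ω : A → ℕ) → (∀ a → 0 ℕ.< ω a) → (ys xs : List A) →
                  (∀ {x} → x ∈ xs → x ∈ ys) → ∀ T → T ℕ.≤ sum (map g xs) →
                  ceiling (divℚ ((+ T) / 1) (maxRatio g ω ys)) ℤ.≤ + sum (map ω xs)
⌈/maxRatio⌉≤sum g ω ω>0 ys xs xs⊆ys T T≤Σg
  with maxℚ≡0⊎∈ (map (λ a → divℕ (g a) (ω a)) ys)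
... | inj₁ ρ≡0 rewrite ρ≡0 = ℤ.+≤+ ℕ.z≤n   -- divℚ returns its junk value 0
... | inj₂ ρ∈ with ∈-map⁻ (λ a → divℕ (g a) (ω a)) ρ∈
... | a , _ , ρ≡ = bound (g a) (ω a) (ω>0 a) ρ≡
  where
  ρ : ℚ
  ρ = maxRatio g ω ys
  bound : ∀ c o → 0 ℕ.< o → ρ ≡ divℕ c o → ceiling (divℚ ((+ T) / 1) ρ) ℤ.≤ + sum (map ω xs)
  bound zero    (suc d) _ ρ≡0/d rewrite ρ≡0/d | 0/suc≡0ℚ d = ℤ.+≤+ ℕ.z≤n
  bound (suc c) (suc d) _ ρ≡c/d rewrite ρ≡c/d =
    ceiling-/-≤ T (sum (map ω xs)) c d
      (ℕP.≤-trans (ℕP.*-monoˡ-≤ (suc d) T≤Σg) (sum-≤-scaled g ω (suc d) (suc c) xs gd≤cω))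
    where
    gd≤cω : ∀ {x} → x ∈ xs → g x ℕ.* suc d ℕ.≤ suc c ℕ.* ω x
    gd≤cω {x} x∈xs = divℕ-≤-/ (g x) (ω x) (suc c) d (ω>0 x)
      (subst (divℕ (g x) (ω x) ℚ.≤_) ρ≡c/d (maxℚ-upper _ (∈-map⁺ (λ a → divℕ (g a) (ω a)) (xs⊆ys x∈xs))))

sum-map-mono-≤ : ∀ {A : Set} {f g : A → ℕ} → (∀ x → f x ≤ g x) → ∀ xs → sum (map f xs) ≤ sum (map g xs)
sum-map-mono-≤ f≤g []       = z≤n
sum-map-mono-≤ f≤g (x ∷ xs) = ℕP.+-mono-≤ (f≤g x) (sum-map-mono-≤ f≤g xs)

sum-map-mono-< : ∀ {A : Set} {f g : A → ℕ} → (∀ x → f x ≤ g x) → ∀ {a xs} → a ∈ xs → f a < g a →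
                 sum (map f xs) < sum (map g xs)
sum-map-mono-< f≤g {xs = x ∷ xs} (here refl) fa<ga = ℕP.+-mono-<-≤ fa<ga (sum-map-mono-≤ f≤g xs)
sum-map-mono-< f≤g {xs = x ∷ xs} (there a∈xs) fa<ga = ℕP.+-mono-≤-< (f≤g x) (sum-map-mono-< f≤g a∈xs fa<ga)

module _ {A S : Set} {R : A → S → Set} (R? : ∀ a s → Dec (R a s)) where

  length-filter-∷-≤ : ∀ a C L → length (filter (R? a) L) ≤ length (filter (R? a) (C ∷ L))
  length-filter-∷-≤ a C L with R? a C
  ... | yes _ = ℕP.n≤1+n _
  ... | no  _ = ℕP.≤-refl

  length≤sum-count : ∀ xs L → (∀ {s} → s ∈ L → ∃[ a ] (a ∈ xs × R a s)) →
                     length L ≤ sum (map (λ a → length (filter (R? a) L)) xs)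
  length≤sum-count xs []      _       = z≤n
  length≤sum-count xs (C ∷ L) covered with covered (here refl)
  ... | a , a∈xs , aRC = ℕP.≤-trans (s≤s (length≤sum-count xs L (covered ∘ there)))
      (sum-map-mono-< (λ b → length-filter-∷-≤ b C L) a∈xs
        (ℕP.≤-reflexive (sym (cong length (LP.filter-accept (R? a) aRC)))))

∣p∪q∣≤∣p∣+∣q∣ : ∀ {n} (p q : Subset n) → ∣ p ∪ q ∣ ≤ ∣ p ∣ ℕ.+ ∣ q ∣
∣p∪q∣≤∣p∣+∣q∣ []            []            = z≤n
∣p∪q∣≤∣p∣+∣q∣ (inside ∷ p)  (inside ∷ q)  =
  s≤s (ℕP.≤-trans (∣p∪q∣≤∣p∣+∣q∣ p q) (ℕP.+-monoʳ-≤ ∣ p ∣ (ℕP.n≤1+n _)))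
∣p∪q∣≤∣p∣+∣q∣ (inside ∷ p)  (outside ∷ q) = s≤s (∣p∪q∣≤∣p∣+∣q∣ p q)
∣p∪q∣≤∣p∣+∣q∣ (outside ∷ p) (inside ∷ q)  =
  subst (suc ∣ p ∪ q ∣ ≤_) (sym (ℕP.+-suc ∣ p ∣ ∣ q ∣)) (s≤s (∣p∪q∣≤∣p∣+∣q∣ p q))
∣p∪q∣≤∣p∣+∣q∣ (outside ∷ p) (outside ∷ q) = ∣p∪q∣≤∣p∣+∣q∣ p q

∣⋃ps∣≤sum∣ps∣ : ∀ {n} (ps : List (Subset n)) → ∣ ⋃ ps ∣ ≤ sum (map ∣_∣ ps)
∣⋃ps∣≤sum∣ps∣ {n} []       = ℕP.≤-reflexive (∣⊥∣≡0 n)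
∣⋃ps∣≤sum∣ps∣     (p ∷ ps) =
  ℕP.≤-trans (∣p∪q∣≤∣p∣+∣q∣ p (⋃ ps)) (ℕP.+-monoʳ-≤ ∣ p ∣ (∣⋃ps∣≤sum∣ps∣ ps))

x∈p∈ps⇒x∈⋃ps : ∀ {n} {x : Fin n} {p ps} → x Sub.∈ p → p ∈ ps → x Sub.∈ ⋃ ps
x∈p∈ps⇒x∈⋃ps x∈p (here refl)  = x∈p∪q⁺ (inj₁ x∈p)
x∈p∈ps⇒x∈⋃ps x∈p (there p∈ps) = x∈p∪q⁺ (inj₂ (x∈p∈ps⇒x∈⋃ps x∈p p∈ps))

fromList : ∀ {n} → List (Fin n) → Subset n
fromList = foldr (λ e s → ⁅ e ⁆ ∪ s) ⊥

∈-fromList⇔ : ∀ {n} (l : List (Fin n)) x → (x Sub.∈ fromList l) ⇔ (x ∈ l)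
∈-fromList⇔ l x = mk⇔ (to l) (from l)
  where
  to : ∀ l → x Sub.∈ fromList l → x ∈ l
  to []      x∈⊥ = ⊥-elim (∉⊥ x∈⊥)
  to (e ∷ l) x∈ with x∈p∪q⁻ ⁅ e ⁆ (fromList l) x∈
  ... | inj₁ x∈⁅e⁆ = here (x∈⁅y⁆⇒x≡y e x∈⁅e⁆)
  ... | inj₂ x∈l   = there (to l x∈l)
  from : ∀ l → x ∈ l → x Sub.∈ fromList l
  from (e ∷ l) (here refl)  = x∈p∪q⁺ (inj₁ (x∈⁅x⁆ x))
  from (e ∷ l) (there x∈l) = x∈p∪q⁺ (inj₂ (from l x∈l))

feedback-meets-cycle : ∀ G {ε l} → AcyclicWithout G ε → DirectedCycle G l → ∃[ e ] (e ∈ l × e Sub.∈ ε)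
feedback-meets-cycle G {ε} {l} acyclic cycle with any? (_∈? ε) l
... | yes meets = find meets
... | no  avoids = ⊥-elim (acyclic (l , cycle , ¬Any⇒All¬ l avoids))

θ≤length : ∀ G ω L e → θ G ω L e ≤ length L
θ≤length G ω L e = LP.length-filter (e ∈?_) L

∈⇒ω≤weight : ∀ G ω {ε} e → e Sub.∈ ε → ω e ≤ weight G ω ε
∈⇒ω≤weight G ω {ε} e e∈ε = ∈⇒≤sum (∈-filter⁺ (_∈? ε) (∈-allFin e) e∈ε)
  where
  ∈⇒≤sum : ∀ {xs} → e ∈ xs → ω e ≤ sum (map ω xs)
  ∈⇒≤sum (here refl)           = ℕP.m≤m+n _ _
  ∈⇒≤sum {x ∷ _} (there e∈xs) = ℕP.≤-trans (∈⇒≤sum e∈xs) (ℕP.m≤n+m _ (ω x))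

module _ (G : Digraph) (ω : Arc G → ℕ) (L : List (Subset (Digraph.m G)))
         (L-enumerates : ∀ C → (C ∈ L) ⇔ IsElemCycle G C)
         {ε : Subset (Digraph.m G)} (acyclic : AcyclicWithout G ε) where
  open Digraph G

  εArcs : List (Arc G)
  εArcs = filter (_∈? ε) (allFin m)

  private
    ∈εArcs : ∀ {e} → e Sub.∈ ε → e ∈ εArcs
    ∈εArcs {e} = ∈-filter⁺ (_∈? ε) (∈-allFin e)

    elemCycle-meets : ∀ {l} → ElementaryCycle G l → ∃[ e ] (e ∈ l × e ∈ εArcs)
    elemCycle-meets (cycle , _) with feedback-meets-cycle G acyclic cycle
    ... | e , e∈l , e∈ε = e , e∈l , ∈εArcs e∈ε

  cycles≤sum-θ : length L ≤ sum (map (θ G ω L) εArcs)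
  cycles≤sum-θ = length≤sum-count (λ e C → e ∈? C) εArcs L covered
    where
    covered : ∀ {C} → C ∈ L → ∃[ e ] (e ∈ εArcs × e Sub.∈ C)
    covered {C} C∈L with Equivalence.to (L-enumerates C) C∈L
    ... | l , elem , C≈l with elemCycle-meets elem
    ... | e , e∈l , e∈εArcs = e , e∈εArcs , Equivalence.from (C≈l e) e∈l

  arcs≤sum-φ : EveryArcOnCycle G → m ≤ sum (map (φ G ω L) εArcs)
  arcs≤sum-φ onCycle = begin
    m                                      ≡⟨ ∣⊤∣≡n m ⟨
    ∣ ⊤ {m} ∣                               ≤⟨ p⊆q⇒∣p∣≤∣q∣ {p = ⊤} (λ {f} _ → covered f) ⟩
    ∣ ⋃ (map Gel εArcs) ∣                   ≤⟨ ∣⋃ps∣≤sum∣ps∣ (map Gel εArcs) ⟩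
    sum (map ∣_∣ (map Gel εArcs))           ≡⟨ cong sum (LP.map-∘ εArcs) ⟨
    sum (map (φ G ω L) εArcs)              ∎
    where
    open ℕP.≤-Reasoning
    Gel : Arc G → Subset m
    Gel e = ⋃ (cyclesThrough G ω L e)
    covered : ∀ f → f Sub.∈ ⋃ (map Gel εArcs)
    covered f with onCycle f
    ... | l , elem , f∈l with elemCycle-meets elem
    ... | e , e∈l , e∈εArcs = x∈p∈ps⇒x∈⋃ps (x∈p∈ps⇒x∈⋃ps f∈C C∈Gel) (∈-map⁺ Gel e∈εArcs)
      where
      C : Subset m
      C = fromList l
      f∈C : f Sub.∈ C
      f∈C = Equivalence.from (∈-fromList⇔ l f) f∈l
      C∈Gel : C ∈ cyclesThrough G ω L e
      C∈Gel = ∈-filter⁺ (e ∈?_) (Equivalence.from (L-enumerates C) (l , elem , ∈-fromList⇔ l))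
                (Equivalence.from (∈-fromList⇔ l e) e∈l)

  module _ (ω>0 : PositiveWeight G ω) where

    μ≤weight : μ G ω L ℤ.≤ + weight G ω ε
    μ≤weight = ⌈/maxRatio⌉≤sum (θ G ω L) ω ω>0 (allFin m) εArcs (λ {e} _ → ∈-allFin e)
                 (length L) cycles≤sum-θ

    υ≤weight : EveryArcOnCycle G → υ G ω L ℤ.≤ + weight G ω ε
    υ≤weight onCycle = ⌈/maxRatio⌉≤sum (φ G ω L) ω ω>0 (allFin m) εArcs (λ {e} _ → ∈-allFin e)
                         m (arcs≤sum-φ onCycle)

Ω≥μ⊔υ : (G : Digraph) (ω : Arc G → ℕ) → Admissible G ω
        → (L : List (Subset (Digraph.m G))) → EnumeratesCycles G L
        → (w : ℕ) → IsΩ G ω w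
        → + w ≥ (μ G ω L ⊔ υ G ω L)
Ω≥μ⊔υ G ω (_ , _ , ω>0 , onCycle) L (_ , L-enumerates) _ ((ε , acyclic , refl) , _) =
  ℤP.⊔-lub (μ≤weight G ω L L-enumerates acyclic ω>0) (υ≤weight G ω L L-enumerates acyclic ω>0 onCycle)

-- Every elementary cycle is a digon {zero, suc j}, so θ(zero) = |O_el| and μ = Ω = 1.
module Digon (k : ℕ) where

  G : Digraph
  G = record { n = 2 ; m = 2 ℕ.+ k ; src = src ; tgt = tgt }
    where
    src tgt : Fin (2 ℕ.+ k) → Fin 2
    src zero    = zero
    src (suc _) = suc zero
    tgt zero    = suc zero
    tgt (suc _) = zero

  ω : Arc G → ℕ
  ω _ = 1

  digon : Fin (suc k) → List (Arc G)
  digon j = zero ∷ suc j ∷ []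

  digon-elementary : ∀ j → ElementaryCycle G (digon j)
  digon-elementary j = ((λ ()) , zero , refl ∷ refl ∷ []) , ((λ ()) ∷ []) ∷ [] ∷ []

  admissible : Admissible G ω
  admissible = loopFree , connected , (λ _ → s≤s z≤n) , onCycle
    where
    loopFree : LoopFree G
    loopFree zero    ()
    loopFree (suc _) ()
    connected : Connected G
    connected zero       zero       = Star.ε
    connected zero       (suc zero) = (zero , inj₁ (refl , refl)) ◅ Star.ε
    connected (suc zero) zero       = (zero , inj₂ (refl , refl)) ◅ Star.ε
    connected (suc zero) (suc zero) = Star.ε
    onCycle : EveryArcOnCycle G
    onCycle zero    = digon zero , digon-elementary zero , here refl
    onCycle (suc j) = digon j , digon-elementary j , there (here refl)

  elementary⇒digon : ∀ {l} → ElementaryCycle G l → ∃[ j ] (∀ e → (e ∈ l) ⇔ (e ∈ digon j))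
  elementary⇒digon ((l≢[] , _ , walk) , unique) = classify _ walk unique l≢[]
    where
    swap : ∀ {j e} → e ∈ suc j ∷ zero ∷ [] → e ∈ digon j
    swap (here refl)         = there (here refl)
    swap (there (here refl)) = here refl
    swap′ : ∀ {j e} → e ∈ digon j → e ∈ suc j ∷ zero ∷ []
    swap′ (here refl)         = there (here refl)
    swap′ (there (here refl)) = here refl
    -- Arcs alternate between zero and back arcs, and a third arc would revisit the start vertex.
    classify : ∀ {u} l → Walk G u l u → Unique (map (Digraph.src G) l) → l ≢ [] →
               ∃[ j ] (∀ e → (e ∈ l) ⇔ (e ∈ digon j))
    classify []                      _                          _                     l≢[] = ⊥-elim (l≢[] refl)
    classify (zero ∷ [])             (refl ∷ ())                _                     _
    classify (zero ∷ zero ∷ _)       (refl ∷ () ∷ _)            _                     _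
    classify (zero ∷ suc j ∷ [])     (refl ∷ refl ∷ [])         _                     _ = j , λ _ → mk⇔ id id
    classify (zero ∷ suc _ ∷ _ ∷ _)  (refl ∷ refl ∷ src≡ ∷ _)  ((_ ∷ ≢src ∷ _) ∷ _) _ = ⊥-elim (≢src (sym src≡))
    classify (suc _ ∷ [])            (refl ∷ ())                _                     _
    classify (suc _ ∷ suc _ ∷ _)     (refl ∷ () ∷ _)            _                     _
    classify (suc j ∷ zero ∷ [])     (refl ∷ refl ∷ [])         _                     _ = j , λ _ → mk⇔ swap swap′
    classify (suc _ ∷ zero ∷ _ ∷ _)  (refl ∷ refl ∷ src≡ ∷ _)  ((_ ∷ ≢src ∷ _) ∷ _) _ = ⊥-elim (≢src (sym src≡))

  cycle : Fin (suc k) → Subset (2 ℕ.+ k)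
  cycle j = fromList (digon j)

  L : List (Subset (2 ℕ.+ k))
  L = tabulate cycle

  enumerates : EnumeratesCycles G L
  enumerates = UniqueP.tabulate⁺ cycle-injective , λ C → mk⇔ (listed⇒elementary C) (elementary⇒listed C)
    where
    cycle-injective : ∀ {i j} → cycle i ≡ cycle j → i ≡ j
    cycle-injective {i} {j} ci≡cj
      with Equivalence.to (∈-fromList⇔ (digon j) (suc i))
             (subst (suc i Sub.∈_) ci≡cj (Equivalence.from (∈-fromList⇔ (digon i) (suc i)) (there (here refl))))
    ... | there (here si≡sj) = FinP.suc-injective si≡sj
    listed⇒elementary : ∀ C → C ∈ L → IsElemCycle G C
    listed⇒elementary C C∈L with ∈-tabulate⁻ {f = cycle} C∈L
    ... | j , refl = digon j , digon-elementary j , ∈-fromList⇔ (digon j)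
    elementary⇒listed : ∀ C → IsElemCycle G C → C ∈ L
    elementary⇒listed C (l , elem , C≈l) with elementary⇒digon elem
    ... | j , l≈digon = subst (_∈ L) (sym C≡cycle) (∈-tabulate⁺ {f = cycle} j)
      where
      C≈cycle : ∀ e → (e Sub.∈ C) ⇔ (e Sub.∈ cycle j)
      C≈cycle e = ⇔-trans (C≈l e) (⇔-trans (l≈digon e) (⇔-sym (∈-fromList⇔ (digon j) e)))
      C≡cycle : C ≡ cycle j
      C≡cycle = ⊆-antisym (Equivalence.to (C≈cycle _)) (Equivalence.from (C≈cycle _))

  Ω≡1 : IsΩ G ω 1
  Ω≡1 = (⁅ zero ⁆ , acyclic , weight≡1) , minimal
    where
    -- Without the arc zero, every arc leaves vertex 1 and enters vertex 0.
    acyclic : AcyclicWithout G ⁅ zero ⁆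
    acyclic (l , (l≢[] , _ , walk) , avoids) = noCycle l walk l≢[] avoids
      where
      noCycle : ∀ {u} l → Walk G u l u → l ≢ [] → ¬ All (λ e → ¬ (e Sub.∈ ⁅ zero ⁆)) l
      noCycle []                 _               l≢[] _              = l≢[] refl
      noCycle (zero ∷ _)         _               _    (∉ ∷ _)        = ∉ (x∈⁅x⁆ zero)
      noCycle (suc _ ∷ [])       (refl ∷ ())     _    _
      noCycle (suc _ ∷ zero ∷ _) _               _    (_ ∷ ∉ ∷ _)    = ∉ (x∈⁅x⁆ zero)
      noCycle (suc _ ∷ suc _ ∷ _) (refl ∷ () ∷ _) _   _
    weight≡1 : weight G ω ⁅ zero ⁆ ≡ 1
    weight≡1 = cong (λ arcs → 1 ℕ.+ sum (map ω arcs)) (LP.filter-none (_∈? ⁅ zero ⁆) backArcs∉)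
      where
      backArcs∉ : All (λ e → ¬ (e Sub.∈ ⁅ zero ⁆)) (tabulate {n = suc k} suc)
      backArcs∉ = AllP.tabulate⁺ {f = suc} (λ j sj∈ → FinP.0≢1+n (sym (x∈⁅y⁆⇒x≡y zero sj∈)))
    minimal : ∀ ε → AcyclicWithout G ε → 1 ≤ weight G ω ε
    minimal ε acyclic′ with feedback-meets-cycle G acyclic′ (proj₁ (digon-elementary zero))
    ... | e , _ , e∈ε = ∈⇒ω≤weight G ω e e∈ε

  θ-zero≡length : θ G ω L zero ≡ length L
  θ-zero≡length = cong length (LP.filter-all (zero ∈?_) (AllP.tabulate⁺ {f = cycle} zero∈cycle))
    where
    zero∈cycle : ∀ j → zero Sub.∈ cycle j
    zero∈cycle j = Equivalence.from (∈-fromList⇔ (digon j) zero) (here refl)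

  ξmax≡ξ-zero : ξmax G ω L ≡ ξ G ω L zero
  ξmax≡ξ-zero = maxℚ-∷ (ξ G ω L zero) _ 0≤ξ-zero ξ≤ξ-zero
    where
    0≤ξ-zero : 0ℚ ℚ.≤ ξ G ω L zero
    0≤ξ-zero = subst (ℚ._≤ ξ G ω L zero) (0/suc≡0ℚ 0) (+/1-mono-≤ 0 (θ G ω L zero) z≤n)
    ξ≤ξ-zero : ∀ {z} → z ∈ map (ξ G ω L) (tabulate suc) → z ℚ.≤ ξ G ω L zero
    ξ≤ξ-zero {z} z∈ with ∈-map⁻ (ξ G ω L) {y = z} {xs = tabulate suc} z∈
    ... | e , _ , refl = +/1-mono-≤ (θ G ω L e) (θ G ω L zero)
                           (subst (θ G ω L e ≤_) (sym θ-zero≡length) (θ≤length G ω L e))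

  μ≡1 : μ G ω L ≡ + 1
  μ≡1 = begin
    ceiling (divℚ ((+ length L) / 1) (ξmax G ω L))    ≡⟨ cong (λ ρ → ceiling (divℚ q ρ)) ξmax≡q ⟩
    ceiling (divℚ q q)                               ≡⟨ cong ceiling (divℚ-pos q q) ⟩
    ceiling (q ℚ.* 1/ q)                             ≡⟨ cong ceiling (ℚP.*-inverseʳ q) ⟩
    + 1                                              ∎
    where
    open ≡-Reasoning
    q : ℚ
    q = (+ length L) / 1
    ξmax≡q : ξmax G ω L ≡ q
    ξmax≡q = trans ξmax≡ξ-zero (cong (λ t → (+ t) / 1) θ-zero≡length)
    instance
      q>0 : Positive q
      q>0 = subst (λ t → Positive ((+ t) / 1)) (sym (LP.length-tabulate cycle)) (ℚP.normalize-pos (suc k) 1)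
      q≢0 : ℚ.NonZero q
      q≢0 = ℚP.pos⇒nonZero q

infinitely-many-tight : (N : ℕ) → Σ[ G ∈ Digraph ] Σ[ ω ∈ (Arc G → ℕ) ]
                        (N ≤ Digraph.m G × Admissible G ω
                         × Σ[ L ∈ List (Subset (Digraph.m G)) ] (EnumeratesCycles G L
                           × Σ[ w ∈ ℕ ] (IsΩ G ω w × (μ G ω L ≡ + w ⊎ υ G ω L ≡ + w))))
infinitely-many-tight N = G , ω , ℕP.m≤n+m N 2 , admissible , L , enumerates , 1 , Ω≡1 , inj₁ μ≡1
  where open Digon N

theorem10 : ((G : Digraph) (ω : Arc G → ℕ) → Admissible G ω
              → (L : List (Subset (Digraph.m G))) → EnumeratesCycles G L
              → (w : ℕ) → IsΩ G ω w
              → + w ≥ (μ G ω L ⊔ υ G ω L))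
            × ((N : ℕ) → Σ[ G ∈ Digraph ] Σ[ ω ∈ (Arc G → ℕ) ]
                (N ≤ Digraph.m G × Admissible G ω
                 × Σ[ L ∈ List (Subset (Digraph.m G)) ] (EnumeratesCycles G L
                   × Σ[ w ∈ ℕ ] (IsΩ G ω w × (μ G ω L ≡ + w ⊎ υ G ω L ≡ + w)))))
theorem10 = Ω≥μ⊔υ , infinitely-many-tight
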